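{- Let $m,d\geq1$. If $x^m-1$ divides $M_d(x)$, then $m$ divides $\varphi(d)$, where $\varphi$ is Euler's totient function.
   Context: $M_d(x)=\frac1d\sum_{e\mid d}\mu(e)x^{d/e}\in\mathbb{Q}[x]$ is the $d$th necklace polynomial, $\mu$ the Möbius function. -}

module Defs where

open import Data.Nat as ℕ using (ℕ; zero; suc; _∸_)
open import Data.Nat.Divisibility using (_∣_; _∣?_)
open import Data.Nat.Primality using (prime?)
open import Data.Nat.Coprimality using (coprime?)
open import Data.Nat.DivMod using (_/_)
open import Data.Integer as ℤ using (ℤ)
open import Data.Rational as ℚ using (ℚ; 0ℚ; 1ℚ; _+_; _*_; -_; _-_)
open import Data.List using (List; []; _∷_; length; filter; map; upTo; sum; foldr)
open import Data.Bool using (if_then_else_)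
open import Relation.Nullary.Decidable using (does; ¬?)
open import Relation.Binary.PropositionalEquality using (_≡_)
open import Data.Product using (∃)

divisors : ℕ → List ℕ
divisors n = filter (_∣? n) (map suc (upTo n))

φ : ℕ → ℕ
φ n = length (filter (λ k → coprime? k n) (map suc (upTo n)))

squarefreeᵇ : ℕ → Data.Bool.Bool
squarefreeᵇ n = foldr (λ k b → if does ((k ℕ.* k) ∣? n) then Data.Bool.false else b)
                      Data.Bool.true (map (λ i → 2 ℕ.+ i) (upTo n))

ω : ℕ → ℕ
ω n = length (filter prime? (divisors n))

μ : ℕ → ℤ
μ n = if squarefreeᵇ n then (ℤ.- ℤ.1ℤ) ℤ.^ ω n else ℤ.0ℤ

-- Polynomials over ℚ as coefficient lists (constant term first)

Poly : Set
Poly = List ℚ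

coeff : Poly → ℕ → ℚ
coeff []       _       = 0ℚ
coeff (a ∷ _)  zero    = a
coeff (_ ∷ as) (suc i) = coeff as i

_≈ₚ_ : Poly → Poly → Set
p ≈ₚ q = ∀ i → coeff p i ≡ coeff q i

_+ₚ_ : Poly → Poly → Poly
[]       +ₚ q        = q
p@(_ ∷ _) +ₚ []      = p
(a ∷ p)  +ₚ (b ∷ q)  = (a + b) ∷ (p +ₚ q)

scaleₚ : ℚ → Poly → Poly
scaleₚ c = map (c *_)

_*ₚ_ : Poly → Poly → Poly
[]      *ₚ q = []
(a ∷ p) *ₚ q = scaleₚ a q +ₚ (0ℚ ∷ (p *ₚ q))

monomial : ℚ → ℕ → Poly
monomial c zero    = c ∷ []
monomial c (suc k) = 0ℚ ∷ monomial c k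

_∣ₚ_ : Poly → Poly → Set
f ∣ₚ g = ∃ λ q → (f *ₚ q) ≈ₚ g

xPowMinusOne : ℕ → Poly
xPowMinusOne m = monomial 1ℚ m +ₚ monomial (- 1ℚ) 0

-- d-th necklace polynomial  M_d(x) = (1/d) Σ_{e ∣ d} μ(e) x^{d/e},
-- for d = suc d′ ≥ 1; divisors e are enumerated as e = suc e′.
necklace : ℕ → Poly
necklace zero      = []   -- not used (d ≥ 1 in the paper)
necklace d@(suc _) =
  foldr (λ e′ acc → monomial (ℚ._/_ (μ (suc e′)) d) (d / suc e′) +ₚ acc) []
        (filter (λ e′ → suc e′ ∣? d) (upTo d))

module Submission where

-- For a weight w : ℕ → ℚ of period m, the linear functional
-- Σ aᵢ xⁱ ↦ Σ aᵢ w(i) vanishes on every multiple of x^m − 1, because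
-- multiplying by x^m only shifts the weights by a period.  Taking w(i) = i mod m
-- and applying it to d·M_d = Σ_{e ∣ d} μ(e) x^{d/e} gives
--         Σ_{e ∣ d} μ(e) · ((d/e) mod m) = 0.
-- On the other hand φ(d) = Σ_{e ∣ d} μ(e) · (d/e); writing d/e = (d/e mod m)
-- + m·⌊(d/e)/m⌋ the first part vanishes, so φ(d) = m · Σ_{e ∣ d} μ(e)·⌊(d/e)/m⌋.

open import Defs
open import Data.Nat as ℕ using (ℕ; zero; suc; _≤_; _<_; _≥_; z≤n; s≤s)
import Data.Nat.Properties as ℕP
open import Data.Nat.Divisibility as ℕD using (_∣_; _∣?_; divides)
open import Data.Nat.DivMod as ℕDM using (_%_; _/_)
import Data.Nat.GCD as GCD
open import Data.Nat.Coprimality as Coprimality using (Coprime; coprime?)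
open import Data.Nat.Primality as Primality using (Prime; prime?)
open import Data.Nat.Primality.Factorisation using (factorise; PrimeFactorisation)
open import Data.Integer as ℤ using (ℤ; +_)
import Data.Integer.Properties as ℤP
import Data.Integer.Solver as ℤSolver
open import Data.Rational as ℚ using (ℚ; mkℚ; 0ℚ; 1ℚ; ↥_)
import Data.Rational.Properties as ℚP
import Data.Rational.Solver as ℚSolver
open import Data.Rational.Unnormalised using (mkℚᵘ; *≡*)
import Data.Rational.Unnormalised.Properties as ℚᵘP
open import Data.List using (List; []; _∷_; foldr; filter; map; upTo; length; _∷ʳ_)
open import Data.Nat.ListAction using (product)
import Data.List.Properties as ListP
open import Data.List.Relation.Unary.All using (All; _∷_)
open import Data.List.Relation.Unary.Any using (here; there)
open import Data.List.Membership.Propositional using (_∈_)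
import Data.List.Membership.Propositional.Properties as ∈P
open import Data.Bool using (Bool; true; false; if_then_else_)
open import Relation.Nullary using (Dec; yes; no; does; ¬_; ¬?)
open import Relation.Unary using (Decidable)
open import Data.Empty using (⊥-elim)
open import Data.Product using (∃; _×_; _,_)
open import Data.Sum using (inj₁; inj₂)
open import Relation.Binary.PropositionalEquality

if-yes : ∀ {A B : Set} (d : Dec A) {x y : B} → A → (if does d then x else y) ≡ x
if-yes (yes _) _ = refl
if-yes (no ¬a) a = ⊥-elim (¬a a)

if-no : ∀ {A B : Set} (d : Dec A) {x y : B} → ¬ A → (if does d then x else y) ≡ y
if-no (yes a) ¬a = ⊥-elim (¬a a)
if-no (no _)  _  = refl

infixr 7 [_]·_
[_]·_ : ∀ {A : Set} → Dec A → ℤ → ℤ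
[ d ]· x = if does d then x else + 0

sumTo : ℕ → (ℕ → ℤ) → ℤ
sumTo zero    f = + 0
sumTo (suc n) f = sumTo n f ℤ.+ f (suc n)

sumTo-cong : ∀ n {f g} → (∀ i → 1 ≤ i → i ≤ n → f i ≡ g i) → sumTo n f ≡ sumTo n g
sumTo-cong zero    _ = refl
sumTo-cong (suc n) h =
  cong₂ ℤ._+_ (sumTo-cong n (λ i 1≤i i≤n → h i 1≤i (ℕP.m≤n⇒m≤1+n i≤n))) (h (suc n) (s≤s z≤n) ℕP.≤-refl)

sumTo-zero : ∀ n {f} → (∀ i → 1 ≤ i → i ≤ n → f i ≡ + 0) → sumTo n f ≡ + 0
sumTo-zero n h = trans (sumTo-cong n h) (zeros n)
  where
  zeros : ∀ n → sumTo n (λ _ → + 0) ≡ + 0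
  zeros zero    = refl
  zeros (suc n) = cong (ℤ._+ + 0) (zeros n)

sumTo-+ : ∀ n f g → sumTo n (λ i → f i ℤ.+ g i) ≡ sumTo n f ℤ.+ sumTo n g
sumTo-+ zero    f g = refl
sumTo-+ (suc n) f g rewrite sumTo-+ n f g =
  solve 4 (λ a b c d → (a :+ b) :+ (c :+ d) := (a :+ c) :+ (b :+ d)) refl
    (sumTo n f) (sumTo n g) (f (suc n)) (g (suc n))
  where open ℤSolver.+-*-Solver

sumTo-*ˡ : ∀ n c f → sumTo n (λ i → c ℤ.* f i) ≡ c ℤ.* sumTo n f
sumTo-*ˡ zero    c f = sym (ℤP.*-zeroʳ c)
sumTo-*ˡ (suc n) c f rewrite sumTo-*ˡ n c f = sym (ℤP.*-distribˡ-+ c (sumTo n f) (f (suc n)))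

sumTo-neg : ∀ n f → sumTo n (λ i → ℤ.- f i) ≡ ℤ.- sumTo n f
sumTo-neg zero    f = refl
sumTo-neg (suc n) f rewrite sumTo-neg n f = sym (ℤP.neg-distrib-+ (sumTo n f) (f (suc n)))

sumTo-const : ∀ n c → sumTo n (λ _ → c) ≡ + n ℤ.* c
sumTo-const zero    c = sym (ℤP.*-zeroˡ c)
sumTo-const (suc n) c rewrite sumTo-const n c =
  solve 2 (λ n c → n :* c :+ c := (con (+ 1) :+ n) :* c) refl (+ n) c
  where open ℤSolver.+-*-Solver

sumTo-split : ∀ a b f → sumTo (a ℕ.+ b) f ≡ sumTo a f ℤ.+ sumTo b (λ i → f (a ℕ.+ i))
sumTo-split a zero    f rewrite ℕP.+-identityʳ a = sym (ℤP.+-identityʳ _)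
sumTo-split a (suc b) f rewrite ℕP.+-suc a b | sumTo-split a b f = ℤP.+-assoc (sumTo a f) _ _

sumTo-swap : ∀ a b (F : ℕ → ℕ → ℤ) →
  sumTo a (λ k → sumTo b (F k)) ≡ sumTo b (λ e → sumTo a (λ k → F k e))
sumTo-swap zero    b F = sym (sumTo-zero b (λ _ _ _ → refl))
sumTo-swap (suc a) b F rewrite sumTo-swap a b F =
  sym (sumTo-+ b (λ e → sumTo a (λ k → F k e)) (F (suc a)))

sumTo-point : ∀ N p → 1 ≤ p → p ≤ N → sumTo N (λ q → [ q ℕ.≟ p ]· + 1) ≡ + 1
sumTo-point zero    p 1≤p p≤0 = ⊥-elim (ℕP.<⇒≱ 1≤p p≤0)
sumTo-point (suc N) p 1≤p p≤N with suc N ℕ.≟ p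
... | yes refl = cong₂ ℤ._+_ (sumTo-zero N (λ i _ i≤N → if-no (i ℕ.≟ suc N) (λ { refl → ℕP.<-irrefl refl i≤N })))
                           (if-yes (suc N ℕ.≟ suc N) refl)
... | no N+1≢p = trans (cong (λ x → sumTo N _ ℤ.+ x) (if-no (suc N ℕ.≟ p) N+1≢p))
               (trans (ℤP.+-identityʳ _)
                      (sumTo-point N p 1≤p (ℕP.≤-pred (ℕP.≤∧≢⇒< p≤N (λ p≡N+1 → N+1≢p (sym p≡N+1))))))

sumTo-divisors : ∀ n N .{{_ : ℕ.NonZero n}} → n ≤ N → ∀ (h : ℕ → ℤ) →
  sumTo N (λ e → [ e ∣? n ]· h e) ≡ sumTo n (λ e → [ e ∣? n ]· h e)
sumTo-divisors n N n≤N h = begin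
  sumTo N f                                            ≡⟨ cong (λ x → sumTo x f) (sym (ℕP.m+[n∸m]≡n n≤N)) ⟩
  sumTo (n ℕ.+ (N ℕ.∸ n)) f                            ≡⟨ sumTo-split n (N ℕ.∸ n) f ⟩
  sumTo n f ℤ.+ sumTo (N ℕ.∸ n) (λ i → f (n ℕ.+ i))    ≡⟨ cong (λ x → sumTo n f ℤ.+ x) (sumTo-zero (N ℕ.∸ n) beyond) ⟩
  sumTo n f ℤ.+ + 0                                    ≡⟨ ℤP.+-identityʳ _ ⟩
  sumTo n f                                            ∎
  where
  open ≡-Reasoning
  f = λ e → [ e ∣? n ]· h e
  beyond : ∀ i → 1 ≤ i → i ≤ N ℕ.∸ n → f (n ℕ.+ i) ≡ + 0
  beyond i 1≤i _ = if-no ((n ℕ.+ i) ∣? n) (λ n+i∣n → ℕP.<⇒≱ (ℕP.m<m+n n 1≤i) (ℕD.∣⇒≤ n+i∣n))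

no-multiple-between : ∀ p N i → 1 ≤ i → i < p → ¬ (p ∣ p ℕ.* N ℕ.+ i)
no-multiple-between p N i 1≤i i<p p∣pN+i =
  ℕP.<⇒≱ i<p (ℕD.∣⇒≤ {{ℕ.>-nonZero 1≤i}} (ℕD.∣m+n∣m⇒∣n p∣pN+i (ℕD.m∣m*n N)))

sumTo-multiples : ∀ p .{{_ : ℕ.NonZero p}} N (g : ℕ → ℤ) →
  sumTo (p ℕ.* N) (λ e → [ p ∣? e ]· g e) ≡ sumTo N (λ j → g (p ℕ.* j))
sumTo-multiples p zero g rewrite ℕP.*-zeroʳ p = refl
sumTo-multiples p@(suc p′) (suc N) g = begin
  sumTo (p ℕ.* suc N) f
    ≡⟨ cong (λ x → sumTo x f) (trans (ℕP.*-suc p N) (ℕP.+-comm p (p ℕ.* N))) ⟩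
  sumTo (p ℕ.* N ℕ.+ p) f
    ≡⟨ sumTo-split (p ℕ.* N) p f ⟩
  sumTo (p ℕ.* N) f ℤ.+ (sumTo p′ (λ i → f (p ℕ.* N ℕ.+ i)) ℤ.+ f (p ℕ.* N ℕ.+ p))
    ≡⟨ cong₂ (λ x y → x ℤ.+ (y ℤ.+ f (p ℕ.* N ℕ.+ p))) (sumTo-multiples p N g) (sumTo-zero p′ gap) ⟩
  sumTo N (λ j → g (p ℕ.* j)) ℤ.+ (+ 0 ℤ.+ f (p ℕ.* N ℕ.+ p))
    ≡⟨ cong (λ x → sumTo N (λ j → g (p ℕ.* j)) ℤ.+ x) (trans (ℤP.+-identityˡ _) next) ⟩
  sumTo (suc N) (λ j → g (p ℕ.* j)) ∎
  where
  open ≡-Reasoning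
  f = λ e → [ p ∣? e ]· g e
  gap : ∀ i → 1 ≤ i → i ≤ p′ → f (p ℕ.* N ℕ.+ i) ≡ + 0
  gap i 1≤i i≤p′ = if-no (p ∣? (p ℕ.* N ℕ.+ i)) (no-multiple-between p N i 1≤i (s≤s i≤p′))
  next : f (p ℕ.* N ℕ.+ p) ≡ g (p ℕ.* suc N)
  next = trans (if-yes (p ∣? (p ℕ.* N ℕ.+ p)) (ℕD.∣m∣n⇒∣m+n (ℕD.m∣m*n N) ℕD.∣-refl))
               (cong g (trans (ℕP.+-comm (p ℕ.* N) p) (sym (ℕP.*-suc p N))))

count-multiples : ∀ n e .{{_ : ℕ.NonZero e}} → sumTo n (λ k → [ e ∣? k ]· + 1) ≡ + (n / e)
count-multiples n e = begin
  sumTo n f                                                ≡⟨ cong (λ x → sumTo x f) n≡e[n/e]+r ⟩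
  sumTo (e ℕ.* (n / e) ℕ.+ n % e) f                        ≡⟨ sumTo-split (e ℕ.* (n / e)) (n % e) f ⟩
  sumTo (e ℕ.* (n / e)) f ℤ.+ sumTo (n % e) (λ i → f (e ℕ.* (n / e) ℕ.+ i))
    ≡⟨ cong₂ ℤ._+_ (sumTo-multiples e (n / e) (λ _ → + 1)) (sumTo-zero (n % e) remainder) ⟩
  sumTo (n / e) (λ _ → + 1) ℤ.+ + 0                        ≡⟨ ℤP.+-identityʳ _ ⟩
  sumTo (n / e) (λ _ → + 1)                                ≡⟨ sumTo-const (n / e) (+ 1) ⟩
  + (n / e) ℤ.* + 1                                        ≡⟨ ℤP.*-identityʳ _ ⟩
  + (n / e)                                                ∎
  where
  open ≡-Reasoning
  f = λ k → [ e ∣? k ]· + 1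
  n≡e[n/e]+r : n ≡ e ℕ.* (n / e) ℕ.+ n % e
  n≡e[n/e]+r = trans (ℕDM.m≡m%n+[m/n]*n n e)
                     (trans (ℕP.+-comm (n % e) _) (cong (ℕ._+ n % e) (ℕP.*-comm (n / e) e)))
  remainder : ∀ i → 1 ≤ i → i ≤ n % e → f (e ℕ.* (n / e) ℕ.+ i) ≡ + 0
  remainder i 1≤i i≤r = if-no (e ∣? (e ℕ.* (n / e) ℕ.+ i))
    (no-multiple-between e (n / e) i 1≤i (ℕP.≤-<-trans i≤r (ℕDM.m%n<n n e)))

sumList : List ℕ → (ℕ → ℤ) → ℤ
sumList xs f = foldr (λ x acc → f x ℤ.+ acc) (+ 0) xs

sumList-filter : ∀ {P : ℕ → Set} (P? : Decidable P) xs f →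
  sumList (filter P? xs) f ≡ sumList xs (λ x → [ P? x ]· f x)
sumList-filter P? []       f = refl
sumList-filter P? (x ∷ xs) f with does (P? x)
... | true  = cong (λ y → f x ℤ.+ y) (sumList-filter P? xs f)
... | false = trans (sumList-filter P? xs f) (sym (ℤP.+-identityˡ _))

length-filter : ∀ {P : ℕ → Set} (P? : Decidable P) xs →
  + length (filter P? xs) ≡ sumList xs (λ x → [ P? x ]· + 1)
length-filter P? []       = refl
length-filter P? (x ∷ xs) with does (P? x)
... | true  = cong (λ y → + 1 ℤ.+ y) (length-filter P? xs)
... | false = trans (length-filter P? xs) (sym (ℤP.+-identityˡ _))

sumList-map : ∀ (g : ℕ → ℕ) xs f → sumList (map g xs) f ≡ sumList xs (λ x → f (g x))
sumList-map g []       f = refl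
sumList-map g (x ∷ xs) f = cong (λ y → f (g x) ℤ.+ y) (sumList-map g xs f)

sumList-upTo : ∀ n h → sumList (upTo n) (λ x → h (suc x)) ≡ sumTo n h
sumList-upTo zero    h = refl
sumList-upTo (suc n) h = begin
  sumList (upTo (suc n)) f                              ≡⟨ cong (λ xs → sumList xs f) (sym (ListP.applyUpTo-∷ʳ (λ x → x) n)) ⟩
  sumList (upTo n ∷ʳ n) f                               ≡⟨ ListP.foldr-∷ʳ _ (+ 0) n (upTo n) ⟩
  foldr (λ x acc → f x ℤ.+ acc) (f n ℤ.+ + 0) (upTo n)  ≡⟨ foldr-from (upTo n) (f n ℤ.+ + 0) ⟩
  sumList (upTo n) f ℤ.+ (f n ℤ.+ + 0)                  ≡⟨ cong₂ ℤ._+_ (sumList-upTo n h) (ℤP.+-identityʳ _) ⟩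
  sumTo (suc n) h                                       ∎
  where
  open ≡-Reasoning
  f = λ x → h (suc x)
  foldr-from : ∀ xs a → foldr (λ x acc → f x ℤ.+ acc) a xs ≡ sumList xs f ℤ.+ a
  foldr-from []       a = sym (ℤP.+-identityˡ a)
  foldr-from (x ∷ xs) a = trans (cong (λ y → f x ℤ.+ y) (foldr-from xs a)) (sym (ℤP.+-assoc (f x) _ a))

sumList-range : ∀ n f → sumList (map suc (upTo n)) f ≡ sumTo n f
sumList-range n f = trans (sumList-map suc (upTo n) f) (sumList-upTo n f)

sumList-filtered-range : ∀ n {P : ℕ → Set} (P? : Decidable P) f →
  sumList (filter P? (map suc (upTo n))) f ≡ sumTo n (λ k → [ P? k ]· f k)
sumList-filtered-range n P? f = trans (sumList-filter P? (map suc (upTo n)) f) (sumList-range n _)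

φ-as-sum : ∀ n → + φ n ≡ sumTo n (λ k → [ coprime? k n ]· + 1)
φ-as-sum n = trans (length-filter (λ k → coprime? k n) (map suc (upTo n))) (sumList-range n _)

ω-as-sum : ∀ n → + ω n ≡ sumTo n (λ q → [ q ∣? n ]· [ prime? q ]· + 1)
ω-as-sum n = trans (length-filter prime? (filter (_∣? n) (map suc (upTo n)))) (sumList-filtered-range n (_∣? n) _)

-- The ring embedding ℤ → ℚ, z ↦ z/1.  Its properties are checked on the
-- unnormalised representation, where they are plain integer identities.
ι : ℤ → ℚ
ι z = mkℚ z 0 (Coprimality.sym (Coprimality.1-coprimeTo _))

ι-+ : ∀ a b → ι a ℚ.+ ι b ≡ ι (a ℤ.+ b)
ι-+ a b = ℚP.toℚᵘ-injective (ℚᵘP.≃-trans (ℚP.toℚᵘ-homo-+ (ι a) (ι b))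
  (*≡* (solve 2 (λ a b → (a :* con (+ 1) :+ b :* con (+ 1)) :* con (+ 1) := (a :+ b) :* con (+ 1)) refl a b)))
  where open ℤSolver.+-*-Solver

ι-* : ∀ a b → ι a ℚ.* ι b ≡ ι (a ℤ.* b)
ι-* a b = ℚP.toℚᵘ-injective (ℚP.toℚᵘ-homo-* (ι a) (ι b))

/-*-cancel : ∀ z d .{{_ : ℕ.NonZero d}} → (z ℚ./ d) ℚ.* ι (+ d) ≡ ι z
/-*-cancel z d@(suc d′) = ℚP.toℚᵘ-injective (ℚᵘP.≃-trans (ℚP.toℚᵘ-homo-* (z ℚ./ d) (ι (+ d)))
  (ℚᵘP.≃-trans (ℚᵘP.*-congʳ (ℚP.toℚᵘ-fromℚᵘ (mkℚᵘ z d′)))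
    (*≡* (solve 2 (λ z d → z :* d :* con (+ 1) := z :* (d :* con (+ 1))) refl z (+ d)))))
  where open ℤSolver.+-*-Solver

module WeightedSum (w : ℕ → ℚ) where

  open ℚSolver.+-*-Solver

  wsum : ℕ → Poly → ℚ
  wsum k []       = 0ℚ
  wsum k (a ∷ p)  = a ℚ.* w k ℚ.+ wsum (suc k) p

  wsum-+ : ∀ k p q → wsum k (p +ₚ q) ≡ wsum k p ℚ.+ wsum k q
  wsum-+ k []      q       = sym (ℚP.+-identityˡ _)
  wsum-+ k (a ∷ p) []      = sym (ℚP.+-identityʳ _)
  wsum-+ k (a ∷ p) (b ∷ q) rewrite wsum-+ (suc k) p q =
    solve 5 (λ a b x y z → (a :+ b) :* x :+ (y :+ z) := (a :* x :+ y) :+ (b :* x :+ z)) refl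
      a b (w k) (wsum (suc k) p) (wsum (suc k) q)

  wsum-scale : ∀ k c p → wsum k (scaleₚ c p) ≡ c ℚ.* wsum k p
  wsum-scale k c []      = sym (ℚP.*-zeroʳ c)
  wsum-scale k c (a ∷ p) rewrite wsum-scale (suc k) c p =
    solve 4 (λ c a x y → c :* a :* x :+ c :* y := c :* (a :* x :+ y)) refl c a (w k) (wsum (suc k) p)

  wsum-monomial : ∀ j k c → wsum k (monomial c j) ≡ c ℚ.* w (j ℕ.+ k)
  wsum-monomial zero    k c = ℚP.+-identityʳ _
  wsum-monomial (suc j) k c = begin
    0ℚ ℚ.* w k ℚ.+ wsum (suc k) (monomial c j)  ≡⟨ cong₂ ℚ._+_ (ℚP.*-zeroˡ (w k)) (wsum-monomial j (suc k) c) ⟩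
    0ℚ ℚ.+ c ℚ.* w (j ℕ.+ suc k)                ≡⟨ ℚP.+-identityˡ _ ⟩
    c ℚ.* w (j ℕ.+ suc k)                       ≡⟨ cong (λ i → c ℚ.* w i) (ℕP.+-suc j k) ⟩
    c ℚ.* w (suc j ℕ.+ k)                       ∎
    where open ≡-Reasoning

  -- wsum only sees coefficients, so it respects ≈ₚ (trailing zeros are invisible).
  wsum-zero : ∀ k p → (∀ i → coeff p i ≡ 0ℚ) → wsum k p ≡ 0ℚ
  wsum-zero k []      _ = refl
  wsum-zero k (a ∷ p) h = trans (cong₂ (λ x y → x ℚ.* w k ℚ.+ y) (h 0) (wsum-zero (suc k) p (λ i → h (suc i))))
                                (trans (ℚP.+-identityʳ _) (ℚP.*-zeroˡ (w k)))

  wsum-≈ : ∀ k p q → p ≈ₚ q → wsum k p ≡ wsum k q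
  wsum-≈ k []      []      _ = refl
  wsum-≈ k []      (b ∷ q) h = sym (wsum-zero k (b ∷ q) (λ i → sym (h i)))
  wsum-≈ k (a ∷ p) []      h = wsum-zero k (a ∷ p) h
  wsum-≈ k (a ∷ p) (b ∷ q) h =
    cong₂ (λ x y → x ℚ.* w k ℚ.+ y) (h 0) (wsum-≈ (suc k) p q (λ i → h (suc i)))

  shiftedSum : ℕ → Poly → Poly → ℚ
  shiftedSum k []      q = 0ℚ
  shiftedSum k (a ∷ p) q = a ℚ.* wsum k q ℚ.+ shiftedSum (suc k) p q

  wsum-* : ∀ k p q → wsum k (p *ₚ q) ≡ shiftedSum k p q
  wsum-* k []      q = refl
  wsum-* k (a ∷ p) q = begin
    wsum k (scaleₚ a q +ₚ (0ℚ ∷ (p *ₚ q)))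
      ≡⟨ wsum-+ k (scaleₚ a q) _ ⟩
    wsum k (scaleₚ a q) ℚ.+ (0ℚ ℚ.* w k ℚ.+ wsum (suc k) (p *ₚ q))
      ≡⟨ cong₂ (λ x y → x ℚ.+ (0ℚ ℚ.* w k ℚ.+ y)) (wsum-scale k a q) (wsum-* (suc k) p q) ⟩
    a ℚ.* wsum k q ℚ.+ (0ℚ ℚ.* w k ℚ.+ shiftedSum (suc k) p q)
      ≡⟨ cong (λ x → a ℚ.* wsum k q ℚ.+ x) (trans (cong (ℚ._+ shiftedSum (suc k) p q) (ℚP.*-zeroˡ (w k))) (ℚP.+-identityˡ _)) ⟩
    shiftedSum k (a ∷ p) q ∎
    where open ≡-Reasoning

  shiftedSum-+ : ∀ k p p′ q → shiftedSum k (p +ₚ p′) q ≡ shiftedSum k p q ℚ.+ shiftedSum k p′ q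
  shiftedSum-+ k []      p′       q = sym (ℚP.+-identityˡ _)
  shiftedSum-+ k (a ∷ p) []       q = sym (ℚP.+-identityʳ _)
  shiftedSum-+ k (a ∷ p) (b ∷ p′) q rewrite shiftedSum-+ (suc k) p p′ q =
    solve 5 (λ a b x y z → (a :+ b) :* x :+ (y :+ z) := (a :* x :+ y) :+ (b :* x :+ z)) refl
      a b (wsum k q) (shiftedSum (suc k) p q) (shiftedSum (suc k) p′ q)

  shiftedSum-monomial : ∀ j k c q → shiftedSum k (monomial c j) q ≡ c ℚ.* wsum (j ℕ.+ k) q
  shiftedSum-monomial zero    k c q = ℚP.+-identityʳ _
  shiftedSum-monomial (suc j) k c q = begin
    0ℚ ℚ.* wsum k q ℚ.+ shiftedSum (suc k) (monomial c j) q
      ≡⟨ cong₂ ℚ._+_ (ℚP.*-zeroˡ (wsum k q)) (shiftedSum-monomial j (suc k) c q) ⟩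
    0ℚ ℚ.+ c ℚ.* wsum (j ℕ.+ suc k) q  ≡⟨ ℚP.+-identityˡ _ ⟩
    c ℚ.* wsum (j ℕ.+ suc k) q         ≡⟨ cong (λ i → c ℚ.* wsum i q) (ℕP.+-suc j k) ⟩
    c ℚ.* wsum (suc j ℕ.+ k) q         ∎
    where open ≡-Reasoning

  module Periodic (m : ℕ) (w-periodic : ∀ k → w (m ℕ.+ k) ≡ w k) where

    wsum-periodic : ∀ k p → wsum (m ℕ.+ k) p ≡ wsum k p
    wsum-periodic k []      = refl
    wsum-periodic k (a ∷ p) = cong₂ (λ x y → a ℚ.* x ℚ.+ y) (w-periodic k)
      (trans (cong (λ i → wsum i p) (sym (ℕP.+-suc m k))) (wsum-periodic (suc k) p))

    wsum-multiple : ∀ q → wsum 0 (xPowMinusOne m *ₚ q) ≡ 0ℚ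
    wsum-multiple q = begin
      wsum 0 (xPowMinusOne m *ₚ q)
        ≡⟨ wsum-* 0 (xPowMinusOne m) q ⟩
      shiftedSum 0 (monomial 1ℚ m +ₚ monomial (ℚ.- 1ℚ) 0) q
        ≡⟨ shiftedSum-+ 0 (monomial 1ℚ m) (monomial (ℚ.- 1ℚ) 0) q ⟩
      shiftedSum 0 (monomial 1ℚ m) q ℚ.+ shiftedSum 0 (monomial (ℚ.- 1ℚ) 0) q
        ≡⟨ cong₂ ℚ._+_ (shiftedSum-monomial m 0 1ℚ q) (shiftedSum-monomial 0 0 (ℚ.- 1ℚ) q) ⟩
      1ℚ ℚ.* wsum (m ℕ.+ 0) q ℚ.+ (ℚ.- 1ℚ) ℚ.* wsum 0 q
        ≡⟨ cong (λ x → 1ℚ ℚ.* x ℚ.+ (ℚ.- 1ℚ) ℚ.* wsum 0 q) (wsum-periodic 0 q) ⟩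
      1ℚ ℚ.* wsum 0 q ℚ.+ (ℚ.- 1ℚ) ℚ.* wsum 0 q
        ≡⟨ solve 1 (λ x → con 1ℚ :* x :+ (:- con 1ℚ) :* x := con 0ℚ) refl (wsum 0 q) ⟩
      0ℚ ∎
      where open ≡-Reasoning

    wsum-divisible : ∀ g → xPowMinusOne m ∣ₚ g → wsum 0 g ≡ 0ℚ
    wsum-divisible g (q , fq≈g) = trans (sym (wsum-≈ 0 (xPowMinusOne m *ₚ q) g fq≈g)) (wsum-multiple q)

-- Quotient with the convention n ÷ 0 = 0, so that divisor sums over {1,…,n}
-- may mention n/e without a non-zero side condition.
_÷_ : ℕ → ℕ → ℕ
n ÷ zero  = 0
n ÷ suc e = n / suc e

-- For an integer-valued weight v, d · wsum 0 M_d is the integer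
-- Σ_{e ∣ d} μ(e) · v(d/e): the 1/d in the coefficients of M_d cancels.
module NecklaceWeightedSum (v : ℕ → ℤ) where

  open WeightedSum (λ k → ι (v k))

  module _ (d : ℕ) .{{_ : ℕ.NonZero d}} where

    necklaceFold : List ℕ → Poly
    necklaceFold = foldr (λ e′ acc → monomial (μ (suc e′) ℚ./ d) (d / suc e′) +ₚ acc) []

    term : ℕ → ℤ
    term e′ = μ (suc e′) ℤ.* v (d / suc e′)

    wsum-necklaceFold : ∀ es → ι (+ d) ℚ.* wsum 0 (necklaceFold es) ≡ ι (sumList es term)
    wsum-necklaceFold []        = ℚP.*-zeroʳ (ι (+ d))
    wsum-necklaceFold (e′ ∷ es) = begin
      D ℚ.* wsum 0 (monomial c j +ₚ rest)                  ≡⟨ cong (D ℚ.*_) (wsum-+ 0 (monomial c j) rest) ⟩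
      D ℚ.* (wsum 0 (monomial c j) ℚ.+ wsum 0 rest)        ≡⟨ ℚP.*-distribˡ-+ D (wsum 0 (monomial c j)) (wsum 0 rest) ⟩
      D ℚ.* wsum 0 (monomial c j) ℚ.+ D ℚ.* wsum 0 rest
        ≡⟨ cong₂ ℚ._+_ (cong (D ℚ.*_) (wsum-monomial j 0 c)) (wsum-necklaceFold es) ⟩
      D ℚ.* (c ℚ.* ι (v (j ℕ.+ 0))) ℚ.+ ι (sumList es term)
        ≡⟨ cong (ℚ._+ ι (sumList es term)) leading ⟩
      ι (term e′) ℚ.+ ι (sumList es term)                  ≡⟨ ι-+ (term e′) (sumList es term) ⟩
      ι (sumList (e′ ∷ es) term)                           ∎
      where
      open ≡-Reasoning
      D    = ι (+ d)
      c    = μ (suc e′) ℚ./ d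
      j    = d / suc e′
      rest = necklaceFold es
      leading : D ℚ.* (c ℚ.* ι (v (j ℕ.+ 0))) ≡ ι (term e′)
      leading = begin
        D ℚ.* (c ℚ.* ι (v (j ℕ.+ 0)))  ≡⟨ sym (ℚP.*-assoc D c _) ⟩
        D ℚ.* c ℚ.* ι (v (j ℕ.+ 0))    ≡⟨ cong₂ ℚ._*_ (trans (ℚP.*-comm D c) (/-*-cancel (μ (suc e′)) d))
                                                      (cong (λ i → ι (v i)) (ℕP.+-identityʳ j)) ⟩
        ι (μ (suc e′)) ℚ.* ι (v j)     ≡⟨ ι-* (μ (suc e′)) (v j) ⟩
        ι (term e′)                    ∎

  wsum-necklace : ∀ d → .{{_ : ℕ.NonZero d}} →
    ι (+ d) ℚ.* wsum 0 (necklace d) ≡ ι (sumTo d (λ e → [ e ∣? d ]· (μ e ℤ.* v (d ÷ e))))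
  wsum-necklace d@(suc _) = trans (wsum-necklaceFold d divisors′)
    (cong ι (trans (sumList-filter (λ e′ → suc e′ ∣? d) (upTo d) (term d))
                   (sumList-upTo d (λ e → [ e ∣? d ]· (μ e ℤ.* v (d ÷ e))))))
    where divisors′ = filter (λ e′ → suc e′ ∣? d) (upTo d)

necklace-residue-sum : ∀ m .{{_ : ℕ.NonZero m}} d .{{_ : ℕ.NonZero d}} →
  xPowMinusOne m ∣ₚ necklace d →
  sumTo d (λ e → [ e ∣? d ]· (μ e ℤ.* + ((d ÷ e) % m))) ≡ + 0
necklace-residue-sum m d x^m-1∣M = cong ↥_ (begin
  ι (sumTo d (λ e → [ e ∣? d ]· (μ e ℤ.* + ((d ÷ e) % m))))  ≡⟨ sym (wsum-necklace d) ⟩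
  ι (+ d) ℚ.* wsum 0 (necklace d)                           ≡⟨ cong (ι (+ d) ℚ.*_) (wsum-divisible (necklace d) x^m-1∣M) ⟩
  ι (+ d) ℚ.* 0ℚ                                            ≡⟨ ℚP.*-zeroʳ (ι (+ d)) ⟩
  ι (+ 0)                                                   ∎)
  where
  open ≡-Reasoning
  open NecklaceWeightedSum (λ k → + (k % m))
  open WeightedSum (λ k → ι (+ (k % m)))
  residue-periodic : ∀ k → ι (+ ((m ℕ.+ k) % m)) ≡ ι (+ (k % m))
  residue-periodic k = cong (λ r → ι (+ r)) (trans (cong (_% m) (ℕP.+-comm m k)) (ℕDM.[m+n]%n≡m%n k m))
  open Periodic m residue-periodic

prime≥2 : ∀ {p} → Prime p → 2 ≤ p
prime≥2 {0}           p-prime = ⊥-elim (Primality.¬prime[0] p-prime)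
prime≥2 {1}           p-prime = ⊥-elim (Primality.¬prime[1] p-prime)
prime≥2 {suc (suc _)} _       = s≤s (s≤s z≤n)

prime∣prime⇒≡ : ∀ {q p} → Prime q → Prime p → q ∣ p → q ≡ p
prime∣prime⇒≡ q-prime p-prime q∣p with Primality.prime⇒irreducible p-prime q∣p
... | inj₁ refl = ⊥-elim (Primality.¬prime[1] q-prime)
... | inj₂ q≡p  = q≡p

prime∤⇒coprime : ∀ {p e} → Prime p → ¬ (p ∣ e) → Coprime e p
prime∤⇒coprime p-prime p∤e (i∣e , i∣p) with Primality.prime⇒irreducible p-prime i∣p
... | inj₁ i≡1 = i≡1
... | inj₂ refl = ⊥-elim (p∤e i∣e)

prime-factor : ∀ n → 2 ≤ n → ∃ λ p → Prime p × p ∣ n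
prime-factor 0 ()
prime-factor 1 (s≤s ())
prime-factor n@(suc (suc _)) _ = first (PrimeFactorisation.factors f)
  (PrimeFactorisation.isFactorisation f) (PrimeFactorisation.factorsPrime f)
  where
  f = factorise n
  first : ∀ ps → n ≡ product ps → All Prime ps → ∃ λ p → Prime p × p ∣ n
  first (p ∷ ps) n≡Πps (p-prime ∷ _) = p , p-prime , subst (p ∣_) (sym n≡Πps) (ℕD.m∣m*n (product ps))

-- squarefreeᵇ n tests the candidates k = 2,…,n+1 for k² ∣ n; for n ≥ 1 it
-- decides "no k ≥ 2 has k² ∣ n".
private
  squareTest : ℕ → ℕ → Bool → Bool
  squareTest n k b = if does ((k ℕ.* k) ∣? n) then false else b

  fold-true : ∀ n ks → (∀ k → k ∈ ks → ¬ (k ℕ.* k ∣ n)) → foldr (squareTest n) true ks ≡ true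
  fold-true n []       _  = refl
  fold-true n (k ∷ ks) ok =
    trans (if-no ((k ℕ.* k) ∣? n) (ok k (here refl))) (fold-true n ks (λ j j∈ks → ok j (there j∈ks)))

  fold-false : ∀ n ks k → k ∈ ks → k ℕ.* k ∣ n → foldr (squareTest n) true ks ≡ false
  fold-false n (k ∷ ks) k (here refl) k²∣n = if-yes ((k ℕ.* k) ∣? n) k²∣n
  fold-false n (j ∷ ks) k (there k∈ks) k²∣n with (j ℕ.* j) ∣? n
  ... | yes _ = refl
  ... | no  _ = fold-false n ks k k∈ks k²∣n

  fold-false⇒ : ∀ n ks → foldr (squareTest n) true ks ≡ false → ∃ λ k → k ∈ ks × k ℕ.* k ∣ n
  fold-false⇒ n (k ∷ ks) fold≡false with (k ℕ.* k) ∣? n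
  ... | yes k²∣n = k , here refl , k²∣n
  ... | no  _ with fold-false⇒ n ks fold≡false
  ...   | j , j∈ks , j²∣n = j , there j∈ks , j²∣n

  candidates : ℕ → List ℕ
  candidates n = map (2 ℕ.+_) (upTo n)

  candidate≥2 : ∀ {n k} → k ∈ candidates n → 2 ≤ k
  candidate≥2 k∈ with ∈P.∈-map⁻ (2 ℕ.+_) k∈
  ... | i , _ , refl = ℕP.m≤m+n 2 i

squarefree-true : ∀ n → (∀ k → 2 ≤ k → ¬ (k ℕ.* k ∣ n)) → squarefreeᵇ n ≡ true
squarefree-true n ok = fold-true n (candidates n) (λ k k∈ → ok k (candidate≥2 k∈))

squarefree-false : ∀ n k → 1 ≤ n → 2 ≤ k → k ℕ.* k ∣ n → squarefreeᵇ n ≡ false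
squarefree-false n (suc (suc i)) 1≤n (s≤s (s≤s z≤n)) k²∣n = fold-false n (candidates n) (2 ℕ.+ i) (∈P.∈-map⁺ (2 ℕ.+_) (∈P.∈-upTo⁺ i<n)) k²∣n
  where
  i<n : i < n
  i<n = ℕP.<-≤-trans (ℕP.m<n+m i {2} (s≤s z≤n))
          (ℕP.≤-trans (ℕP.m≤m*n (2 ℕ.+ i) (2 ℕ.+ i)) (ℕD.∣⇒≤ {{ℕ.>-nonZero 1≤n}} k²∣n))

squarefree-false⇒square : ∀ n → squarefreeᵇ n ≡ false → ∃ λ k → 2 ≤ k × k ℕ.* k ∣ n
squarefree-false⇒square n sf≡false with fold-false⇒ n (candidates n) sf≡false
... | k , k∈ , k²∣n = k , candidate≥2 k∈ , k²∣n

squarefree⇒no-square : ∀ n → 1 ≤ n → squarefreeᵇ n ≡ true → ∀ k → 2 ≤ k → ¬ (k ℕ.* k ∣ n)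
squarefree⇒no-square n 1≤n sf≡true k 2≤k k²∣n with trans (sym sf≡true) (squarefree-false n k 1≤n 2≤k k²∣n)
... | ()

μ-squarefree : ∀ n → squarefreeᵇ n ≡ true → μ n ≡ (ℤ.- ℤ.1ℤ) ℤ.^ ω n
μ-squarefree n sf≡true = cong (λ b → if b then (ℤ.- ℤ.1ℤ) ℤ.^ ω n else ℤ.0ℤ) sf≡true

μ-not-squarefree : ∀ n → squarefreeᵇ n ≡ false → μ n ≡ + 0
μ-not-squarefree n sf≡false = cong (λ b → if b then (ℤ.- ℤ.1ℤ) ℤ.^ ω n else ℤ.0ℤ) sf≡false

1≤p*j : ∀ {p j} → Prime p → 1 ≤ j → 1 ≤ p ℕ.* j
1≤p*j p-prime 1≤j = ℕP.*-mono-≤ (ℕP.≤-trans (s≤s z≤n) (prime≥2 p-prime)) 1≤j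

j≤p*j : ∀ {p j} → Prime p → j ≤ p ℕ.* j
j≤p*j {suc p} {j} _ = ℕP.m≤m+n j (p ℕ.* j)

prime-divisor-of-p*j : ∀ {q p j} → Prime p → ¬ (p ∣ j) →
  (q∣pj : Dec (q ∣ p ℕ.* j)) (q-prime : Dec (Prime q)) (q∣j : Dec (q ∣ j)) (q≡p : Dec (q ≡ p)) →
  [ q∣pj ]· [ q-prime ]· + 1 ≡ [ q∣j ]· [ q-prime ]· + 1 ℤ.+ [ q≡p ]· + 1
prime-divisor-of-p*j p-prime p∤j (yes _)     _      (yes p∣j) (yes refl) = ⊥-elim (p∤j p∣j)
prime-divisor-of-p*j p-prime p∤j (yes _)     (no q∤) _        (yes refl) = ⊥-elim (q∤ p-prime)
prime-divisor-of-p*j {p = p} {j} p-prime p∤j (yes q∣pj) (yes q-prime) (no q∤j) (no q≢p)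
  with Primality.euclidsLemma p j q-prime q∣pj
... | inj₁ q∣p = ⊥-elim (q≢p (prime∣prime⇒≡ q-prime p-prime q∣p))
... | inj₂ q∣j = ⊥-elim (q∤j q∣j)
prime-divisor-of-p*j {p = p} p-prime p∤j (no q∤pj) _ (yes q∣j) _ = ⊥-elim (q∤pj (ℕD.∣-trans q∣j (ℕD.n∣m*n p)))
prime-divisor-of-p*j {j = j} p-prime p∤j (no q∤pj) _ (no _) (yes refl) = ⊥-elim (q∤pj (ℕD.m∣m*n j))
prime-divisor-of-p*j p-prime p∤j (yes _) (yes _) (yes _) (no _) = refl
prime-divisor-of-p*j p-prime p∤j (yes _) (yes _) (no _)  (yes _) = refl
prime-divisor-of-p*j p-prime p∤j (yes _) (no _)  (yes _) (no _) = refl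
prime-divisor-of-p*j p-prime p∤j (yes _) (no _)  (no _)  (no _) = refl
prime-divisor-of-p*j p-prime p∤j (no _)  _       (no _)  (no _) = refl

ω-p*j : ∀ {p j} → Prime p → ¬ (p ∣ j) → 1 ≤ j → ω (p ℕ.* j) ≡ suc (ω j)
ω-p*j {p} {j} p-prime p∤j 1≤j = ℤP.+-injective (begin
  + ω (p ℕ.* j)
    ≡⟨ ω-as-sum (p ℕ.* j) ⟩
  sumTo (p ℕ.* j) (λ q → [ q ∣? p ℕ.* j ]· [ prime? q ]· + 1)
    ≡⟨ sumTo-cong (p ℕ.* j) (λ q _ _ → prime-divisor-of-p*j p-prime p∤j (q ∣? p ℕ.* j) (prime? q) (q ∣? j) (q ℕ.≟ p)) ⟩
  sumTo (p ℕ.* j) (λ q → [ q ∣? j ]· [ prime? q ]· + 1 ℤ.+ [ q ℕ.≟ p ]· + 1)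
    ≡⟨ sumTo-+ (p ℕ.* j) _ _ ⟩
  sumTo (p ℕ.* j) (λ q → [ q ∣? j ]· [ prime? q ]· + 1) ℤ.+ sumTo (p ℕ.* j) (λ q → [ q ℕ.≟ p ]· + 1)
    ≡⟨ cong₂ ℤ._+_ (sumTo-divisors j (p ℕ.* j) {{ℕ.>-nonZero 1≤j}} (j≤p*j p-prime) (λ q → [ prime? q ]· + 1))
                   (sumTo-point (p ℕ.* j) p (ℕP.≤-trans (s≤s z≤n) (prime≥2 p-prime)) p≤p*j) ⟩
  sumTo j (λ q → [ q ∣? j ]· [ prime? q ]· + 1) ℤ.+ + 1
    ≡⟨ cong (ℤ._+ + 1) (sym (ω-as-sum j)) ⟩
  + ω j ℤ.+ + 1
    ≡⟨ ℤP.+-comm (+ ω j) (+ 1) ⟩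
  + suc (ω j) ∎)
  where
  open ≡-Reasoning
  p≤p*j : p ≤ p ℕ.* j
  p≤p*j = subst (_≤ p ℕ.* j) (ℕP.*-identityʳ p) (ℕP.*-monoʳ-≤ p 1≤j)

-- Multiplying a squarefree j by a prime p ∤ j keeps it squarefree: a prime
-- square q² ∣ p·j has q ≠ p, so q² is coprime to p and divides j.
squarefree-p*j : ∀ {p j} → Prime p → ¬ (p ∣ j) → 1 ≤ j → squarefreeᵇ j ≡ true → squarefreeᵇ (p ℕ.* j) ≡ true
squarefree-p*j {p} {j} p-prime p∤j 1≤j j-sf = squarefree-true (p ℕ.* j) no-square
  where
  no-square : ∀ k → 2 ≤ k → ¬ (k ℕ.* k ∣ p ℕ.* j)
  no-square k 2≤k k²∣pj with prime-factor k 2≤k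
  ... | q , q-prime , q∣k = squarefree⇒no-square j 1≤j j-sf q (prime≥2 q-prime)
          (Coprimality.coprime-divisor (prime∤⇒coprime p-prime p∤q²) q²∣pj)
    where
    instance _ = Primality.prime⇒nonZero p-prime
    q²∣pj : q ℕ.* q ∣ p ℕ.* j
    q²∣pj = ℕD.∣-trans (ℕD.*-pres-∣ q∣k q∣k) k²∣pj
    p≢q : p ≢ q
    p≢q refl = p∤j (ℕD.*-cancelˡ-∣ p q²∣pj)
    p∤q² : ¬ (p ∣ q ℕ.* q)
    p∤q² p∣q² with Primality.euclidsLemma q q p-prime p∣q²
    ... | inj₁ p∣q = p≢q (prime∣prime⇒≡ p-prime q-prime p∣q)
    ... | inj₂ p∣q = p≢q (prime∣prime⇒≡ p-prime q-prime p∣q)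

μ-p*j-dividing : ∀ {p j} → Prime p → p ∣ j → 1 ≤ j → μ (p ℕ.* j) ≡ + 0
μ-p*j-dividing {p} {j} p-prime p∣j 1≤j = μ-not-squarefree (p ℕ.* j)
  (squarefree-false (p ℕ.* j) p (1≤p*j p-prime 1≤j) (prime≥2 p-prime) (ℕD.*-monoʳ-∣ p p∣j))

μ-p*j-coprime : ∀ {p j} → Prime p → ¬ (p ∣ j) → 1 ≤ j → μ (p ℕ.* j) ≡ ℤ.- μ j
μ-p*j-coprime {p} {j} p-prime p∤j 1≤j = by-squarefreeness (squarefreeᵇ j) refl
  where
  open ≡-Reasoning
  by-squarefreeness : ∀ b → squarefreeᵇ j ≡ b → μ (p ℕ.* j) ≡ ℤ.- μ j
  by-squarefreeness true j-sf = begin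
    μ (p ℕ.* j)                          ≡⟨ μ-squarefree (p ℕ.* j) (squarefree-p*j p-prime p∤j 1≤j j-sf) ⟩
    (ℤ.- ℤ.1ℤ) ℤ.^ ω (p ℕ.* j)           ≡⟨ cong ((ℤ.- ℤ.1ℤ) ℤ.^_) (ω-p*j p-prime p∤j 1≤j) ⟩
    (ℤ.- ℤ.1ℤ) ℤ.* (ℤ.- ℤ.1ℤ) ℤ.^ ω j    ≡⟨ ℤP.-1*i≡-i _ ⟩
    ℤ.- ((ℤ.- ℤ.1ℤ) ℤ.^ ω j)             ≡⟨ cong ℤ.-_ (sym (μ-squarefree j j-sf)) ⟩
    ℤ.- μ j                              ∎
  by-squarefreeness false j-sf with squarefree-false⇒square j j-sf
  ... | k , 2≤k , k²∣j = begin
    μ (p ℕ.* j)  ≡⟨ μ-not-squarefree (p ℕ.* j) (squarefree-false (p ℕ.* j) k (1≤p*j p-prime 1≤j) 2≤k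
                                                  (ℕD.∣-trans k²∣j (ℕD.n∣m*n p))) ⟩
    + 0          ≡⟨ cong ℤ.-_ (sym (μ-not-squarefree j j-sf)) ⟩
    ℤ.- μ j      ∎

-- Σ_{e ∣ n} μ(e) vanishes for n ≥ 2.  Write n = p·n′ with p prime and split the
-- divisors of n into those prime to p (the divisors e of n′ with p ∤ e) and
-- those of the form p·j with j ∣ n′; μ(p·j) = −[p ∤ j]·μ(j) makes the two
-- parts cancel.
mobiusSum : ℕ → ℤ
mobiusSum n = sumTo n (λ e → [ e ∣? n ]· μ e)

module _ {p n′ : ℕ} (p-prime : Prime p) (1≤n′ : 1 ≤ n′) where

  private
    instance _ = Primality.prime⇒nonZero p-prime
    n = p ℕ.* n′

    coprimePart : ℕ → ℤ
    coprimePart e = [ e ∣? n′ ]· [ ¬? (p ∣? e) ]· μ e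

  divisor-split : ∀ e (e∣n : Dec (e ∣ n)) (e∣n′ : Dec (e ∣ n′)) (p∣e : Dec (p ∣ e)) →
    [ e∣n ]· μ e ≡ [ e∣n′ ]· [ ¬? p∣e ]· μ e ℤ.+ [ p∣e ]· [ e∣n ]· μ e
  divisor-split e (yes _)   (yes _)   (yes _)   = sym (ℤP.+-identityˡ _)
  divisor-split e (yes _)   (no _)    (yes _)   = sym (ℤP.+-identityˡ _)
  divisor-split e (no _)    (no _)    (yes _)   = refl
  divisor-split e (yes _)   (yes _)   (no _)    = sym (ℤP.+-identityʳ _)
  divisor-split e (no _)    (no _)    (no _)    = refl
  divisor-split e (yes e∣n) (no e∤n′) (no p∤e)  =
    ⊥-elim (e∤n′ (Coprimality.coprime-divisor (prime∤⇒coprime p-prime p∤e) e∣n))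
  divisor-split e (no e∤n)  (yes e∣n′) _        = ⊥-elim (e∤n (ℕD.∣-trans e∣n′ (ℕD.n∣m*n p)))

  multiple-of-p : ∀ j → 1 ≤ j → (pj∣n : Dec (p ℕ.* j ∣ n)) (j∣n′ : Dec (j ∣ n′)) (p∣j : Dec (p ∣ j)) →
    [ pj∣n ]· μ (p ℕ.* j) ≡ ℤ.- ([ j∣n′ ]· [ ¬? p∣j ]· μ j)
  multiple-of-p j 1≤j (yes _)    (yes _)    (yes p∣j) = μ-p*j-dividing p-prime p∣j 1≤j
  multiple-of-p j 1≤j (yes _)    (yes _)    (no p∤j)  = μ-p*j-coprime p-prime p∤j 1≤j
  multiple-of-p j 1≤j (no _)     (no _)     _         = refl
  multiple-of-p j 1≤j (yes pj∣n) (no j∤n′)  _         = ⊥-elim (j∤n′ (ℕD.*-cancelˡ-∣ p pj∣n))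
  multiple-of-p j 1≤j (no pj∤n)  (yes j∣n′) _         = ⊥-elim (pj∤n (ℕD.*-monoʳ-∣ p j∣n′))

  mobiusSum-p*n′ : mobiusSum n ≡ + 0
  mobiusSum-p*n′ = begin
    sumTo n (λ e → [ e ∣? n ]· μ e)
      ≡⟨ sumTo-cong n (λ e _ _ → divisor-split e (e ∣? n) (e ∣? n′) (p ∣? e)) ⟩
    sumTo n (λ e → coprimePart e ℤ.+ [ p ∣? e ]· [ e ∣? n ]· μ e)
      ≡⟨ sumTo-+ n coprimePart _ ⟩
    sumTo n coprimePart ℤ.+ sumTo n (λ e → [ p ∣? e ]· [ e ∣? n ]· μ e)
      ≡⟨ cong₂ ℤ._+_ (sumTo-divisors n′ n {{ℕ.>-nonZero 1≤n′}} (j≤p*j p-prime) (λ e → [ ¬? (p ∣? e) ]· μ e))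
                     (sumTo-multiples p n′ (λ e → [ e ∣? n ]· μ e)) ⟩
    sumTo n′ coprimePart ℤ.+ sumTo n′ (λ j → [ p ℕ.* j ∣? n ]· μ (p ℕ.* j))
      ≡⟨ cong (λ x → sumTo n′ coprimePart ℤ.+ x)
              (sumTo-cong n′ (λ j 1≤j _ → multiple-of-p j 1≤j (p ℕ.* j ∣? n) (j ∣? n′) (p ∣? j))) ⟩
    sumTo n′ coprimePart ℤ.+ sumTo n′ (λ j → ℤ.- coprimePart j)
      ≡⟨ cong (λ x → sumTo n′ coprimePart ℤ.+ x) (sumTo-neg n′ coprimePart) ⟩
    sumTo n′ coprimePart ℤ.+ ℤ.- sumTo n′ coprimePart
      ≡⟨ ℤP.+-inverseʳ (sumTo n′ coprimePart) ⟩
    + 0 ∎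
    where open ≡-Reasoning

mobiusSum-≥2 : ∀ n → 2 ≤ n → mobiusSum n ≡ + 0
mobiusSum-≥2 n 2≤n with prime-factor n 2≤n
... | p , p-prime , divides zero      n≡0   = ⊥-elim (ℕP.≤⇒≯ (ℕP.≤-reflexive n≡0) (ℕP.≤-trans (s≤s z≤n) 2≤n))
... | p , p-prime , divides (suc n″) n≡n′p =
  subst (λ x → mobiusSum x ≡ + 0) (sym (trans n≡n′p (ℕP.*-comm (suc n″) p))) (mobiusSum-p*n′ p-prime (s≤s z≤n))

-- Detecting coprimality with μ:  [gcd(k,n) = 1] = Σ_{e ∣ n, e ∣ k} μ(e),
-- since the common divisors of k and n are the divisors of g = gcd(k,n).
coprime-indicator : ∀ k n → 1 ≤ n →
  [ coprime? k n ]· + 1 ≡ sumTo n (λ e → [ e ∣? n ]· [ e ∣? k ]· μ e)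
coprime-indicator k n 1≤n = sym (begin
  sumTo n (λ e → [ e ∣? n ]· [ e ∣? k ]· μ e)  ≡⟨ sumTo-cong n (λ e _ _ → common-divisor e (e ∣? n) (e ∣? k) (e ∣? g)) ⟩
  sumTo n (λ e → [ e ∣? g ]· μ e)              ≡⟨ sumTo-divisors g n {{g≢0}} g≤n μ ⟩
  mobiusSum g                                  ≡⟨ by-gcd (coprime? k n) ⟩
  [ coprime? k n ]· + 1                        ∎)
  where
  open ≡-Reasoning
  instance _ = ℕ.>-nonZero 1≤n
  g = GCD.gcd k n
  g≢0 : ℕ.NonZero g
  g≢0 = ℕ.≢-nonZero (λ g≡0 → ℕ.≢-nonZero⁻¹ n (GCD.gcd[m,n]≡0⇒n≡0 k g≡0))
  g≤n : g ≤ n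
  g≤n = ℕD.∣⇒≤ (GCD.gcd[m,n]∣n k n)
  common-divisor : ∀ e (e∣n : Dec (e ∣ n)) (e∣k : Dec (e ∣ k)) (e∣g : Dec (e ∣ g)) →
    [ e∣n ]· [ e∣k ]· μ e ≡ [ e∣g ]· μ e
  common-divisor e (yes _)   (yes _)   (yes _)   = refl
  common-divisor e (yes e∣n) (yes e∣k) (no e∤g)  = ⊥-elim (e∤g (GCD.gcd-greatest e∣k e∣n))
  common-divisor e (yes _)   (no e∤k)  (yes e∣g) = ⊥-elim (e∤k (ℕD.∣-trans e∣g (GCD.gcd[m,n]∣m k n)))
  common-divisor e (yes _)   (no _)    (no _)    = refl
  common-divisor e (no e∤n)  _         (yes e∣g) = ⊥-elim (e∤n (ℕD.∣-trans e∣g (GCD.gcd[m,n]∣n k n)))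
  common-divisor e (no _)    _         (no _)    = refl
  by-gcd : (c : Dec (Coprime k n)) → mobiusSum g ≡ [ c ]· + 1
  by-gcd (yes k⊥n) = cong mobiusSum (Coprimality.coprime⇒gcd≡1 k⊥n)
  by-gcd (no ¬k⊥n) = mobiusSum-≥2 g 2≤g
    where
    2≤g : 2 ≤ g
    2≤g = ℕP.≤∧≢⇒< (ℕ.>-nonZero⁻¹ g {{g≢0}}) (λ 1≡g → ¬k⊥n (Coprimality.gcd≡1⇒coprime (sym 1≡g)))

-- Second half of the argument:  φ(n) = Σ_{e ∣ n} μ(e) · (n/e), obtained by
-- summing the coprimality indicator over k and exchanging the two sums; the
-- inner sum counts the multiples of e in {1,…,n}.
φ-mobius : ∀ n → 1 ≤ n → + φ n ≡ sumTo n (λ e → [ e ∣? n ]· (μ e ℤ.* + (n ÷ e)))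
φ-mobius n 1≤n = begin
  + φ n
    ≡⟨ φ-as-sum n ⟩
  sumTo n (λ k → [ coprime? k n ]· + 1)
    ≡⟨ sumTo-cong n (λ k _ _ → coprime-indicator k n 1≤n) ⟩
  sumTo n (λ k → sumTo n (λ e → [ e ∣? n ]· [ e ∣? k ]· μ e))
    ≡⟨ sumTo-swap n n (λ k e → [ e ∣? n ]· [ e ∣? k ]· μ e) ⟩
  sumTo n (λ e → sumTo n (λ k → [ e ∣? n ]· [ e ∣? k ]· μ e))
    ≡⟨ sumTo-cong n (λ e 1≤e _ → multiples-of-divisor e 1≤e (e ∣? n)) ⟩
  sumTo n (λ e → [ e ∣? n ]· (μ e ℤ.* + (n ÷ e))) ∎
  where
  open ≡-Reasoning
  factor-μ : ∀ e {k} (e∣k : Dec (e ∣ k)) → [ e∣k ]· μ e ≡ μ e ℤ.* ([ e∣k ]· + 1)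
  factor-μ e (yes _) = sym (ℤP.*-identityʳ (μ e))
  factor-μ e (no _)  = sym (ℤP.*-zeroʳ (μ e))
  multiples-of-divisor : ∀ e → 1 ≤ e → (e∣n : Dec (e ∣ n)) →
    sumTo n (λ k → [ e∣n ]· [ e ∣? k ]· μ e) ≡ [ e∣n ]· (μ e ℤ.* + (n ÷ e))
  multiples-of-divisor e       _ (no _)  = sumTo-zero n (λ _ _ _ → refl)
  multiples-of-divisor (suc e) _ (yes _) = begin
    sumTo n (λ k → [ suc e ∣? k ]· μ (suc e))            ≡⟨ sumTo-cong n (λ k _ _ → factor-μ (suc e) (suc e ∣? k)) ⟩
    sumTo n (λ k → μ (suc e) ℤ.* ([ suc e ∣? k ]· + 1))    ≡⟨ sumTo-*ˡ n (μ (suc e)) _ ⟩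
    μ (suc e) ℤ.* sumTo n (λ k → [ suc e ∣? k ]· + 1)    ≡⟨ cong (μ (suc e) ℤ.*_) (count-multiples n (suc e)) ⟩
    μ (suc e) ℤ.* + (n / suc e)                          ∎

sumTo-divMod : ∀ n m .{{_ : ℕ.NonZero m}} {P : ℕ → Set} (P? : Decidable P) (f : ℕ → ℤ) (q : ℕ → ℕ) →
  sumTo n (λ e → [ P? e ]· (f e ℤ.* + q e))
    ≡ sumTo n (λ e → [ P? e ]· (f e ℤ.* + (q e % m))) ℤ.+ + m ℤ.* sumTo n (λ e → [ P? e ]· (f e ℤ.* + (q e / m)))
sumTo-divMod n m {P} P? f q = begin
  sumTo n (λ e → [ P? e ]· (f e ℤ.* + q e))
    ≡⟨ sumTo-cong n (λ e _ _ → pointwise e (P? e)) ⟩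
  sumTo n (λ e → [ P? e ]· (f e ℤ.* + (q e % m)) ℤ.+ + m ℤ.* ([ P? e ]· (f e ℤ.* + (q e / m))))
    ≡⟨ sumTo-+ n _ _ ⟩
  sumTo n (λ e → [ P? e ]· (f e ℤ.* + (q e % m))) ℤ.+ sumTo n (λ e → + m ℤ.* ([ P? e ]· (f e ℤ.* + (q e / m))))
    ≡⟨ cong (λ x → sumTo n (λ e → [ P? e ]· (f e ℤ.* + (q e % m))) ℤ.+ x) (sumTo-*ˡ n (+ m) _) ⟩
  sumTo n (λ e → [ P? e ]· (f e ℤ.* + (q e % m))) ℤ.+ + m ℤ.* sumTo n (λ e → [ P? e ]· (f e ℤ.* + (q e / m))) ∎
  where
  open ≡-Reasoning
  open ℤSolver.+-*-Solver
  q≡r+m*d : ∀ e → + q e ≡ + (q e % m) ℤ.+ + (q e / m) ℤ.* + m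
  q≡r+m*d e = trans (cong +_ (ℕDM.m≡m%n+[m/n]*n (q e) m))
                    (trans (ℤP.pos-+ (q e % m) _) (cong (λ y → + (q e % m) ℤ.+ y) (ℤP.pos-* (q e / m) m)))
  pointwise : ∀ e (Pe : Dec (P e)) →
    [ Pe ]· (f e ℤ.* + q e) ≡ [ Pe ]· (f e ℤ.* + (q e % m)) ℤ.+ + m ℤ.* ([ Pe ]· (f e ℤ.* + (q e / m)))
  pointwise e (no _)  = sym (cong (ℤ._+_ (+ 0)) (ℤP.*-zeroʳ (+ m)))
  pointwise e (yes _) = trans (cong (f e ℤ.*_) (q≡r+m*d e))
    (solve 4 (λ a r d m → a :* (r :+ d :* m) := a :* r :+ m :* (a :* d)) refl (f e) (+ (q e % m)) (+ (q e / m)) (+ m))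

theorem2p14 : (m d : ℕ) → m ≥ 1 → d ≥ 1 →
    xPowMinusOne m ∣ₚ necklace d → m ∣ φ d
theorem2p14 m@(suc _) d _ 1≤d x^m-1∣M = divides ℤ.∣ X ∣ (begin
  φ d                    ≡⟨ cong ℤ.∣_∣ φ≡m*X ⟩
  ℤ.∣ + m ℤ.* X ∣        ≡⟨ ℤP.abs-* (+ m) X ⟩
  m ℕ.* ℤ.∣ X ∣          ≡⟨ ℕP.*-comm m ℤ.∣ X ∣ ⟩
  ℤ.∣ X ∣ ℕ.* m          ∎)
  where
  open ≡-Reasoning
  instance _ = ℕ.>-nonZero 1≤d
  X : ℤ
  X = sumTo d (λ e → [ e ∣? d ]· (μ e ℤ.* + ((d ÷ e) / m)))
  φ≡m*X : + φ d ≡ + m ℤ.* X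
  φ≡m*X = begin
    + φ d                                                                   ≡⟨ φ-mobius d 1≤d ⟩
    sumTo d (λ e → [ e ∣? d ]· (μ e ℤ.* + (d ÷ e)))                         ≡⟨ sumTo-divMod d m (_∣? d) μ (d ÷_) ⟩
    sumTo d (λ e → [ e ∣? d ]· (μ e ℤ.* + ((d ÷ e) % m))) ℤ.+ + m ℤ.* X     ≡⟨ cong (ℤ._+ + m ℤ.* X) (necklace-residue-sum m d x^m-1∣M) ⟩
    + 0 ℤ.+ + m ℤ.* X                                                       ≡⟨ ℤP.+-identityˡ _ ⟩
    + m ℤ.* X                                                               ∎
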